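{- If $k\ge 2$ and $\ell\ge 3$, then $\mathrm{gp}(\Theta(k,\ell)) = k+1$.
   Context: For $k\ge 2$ and $\ell\ge 2$, the theta graph $\Theta(k,\ell)$ consists of two vertices $A$ and $B$ joined by $k$ internally vertex-disjoint paths, each of length $\ell$. For a connected graph $G$, a set $S\subseteq V(G)$ is a general position set if no three distinct vertices of $S$ lie on a common geodesic (shortest path) of $G$; $\mathrm{gp}(G)$ denotes the maximum cardinality of a general position set of $G$. -}

module Defs where

open import Data.Nat using (ℕ; zero; suc; _+_; _∸_; _≤_)
open import Data.Fin using (Fin; toℕ)
open import Data.List using (List; []; _∷_; length)
open import Data.List.Membership.Propositional using (_∈_)
open import Data.List.Relation.Unary.Unique.Propositional using (Unique)
open import Data.Product using (Σ; _×_; ∃)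
open import Relation.Binary.PropositionalEquality using (_≡_; _≢_)
open import Relation.Nullary using (¬_)

module _ {V : Set} (E : V → V → Set) where

  data Walk : V → V → Set where
    [] : ∀ {u} → Walk u u
    _∷_ : ∀ {u w v} → E u w → Walk w v → Walk u v

  walkLength : ∀ {u v} → Walk u v → ℕ
  walkLength [] = zero
  walkLength (_ ∷ p) = suc (walkLength p)

  walkVertices : ∀ {u v} → Walk u v → List V
  walkVertices {u} [] = u ∷ []
  walkVertices {u} (_ ∷ p) = u ∷ walkVertices p

  -- a geodesic: a u,v-walk of minimum length among all u,v-walks
  -- (such a walk is automatically a path)
  IsGeodesic : ∀ {u v} → Walk u v → Set
  IsGeodesic {u} {v} p = (q : Walk u v) → walkLength p ≤ walkLength q

  OnCommonGeodesic : V → V → V → Set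
  OnCommonGeodesic x y z =
    Σ V λ u → Σ V λ v → Σ (Walk u v) λ p →
      IsGeodesic p × (x ∈ walkVertices p) × (y ∈ walkVertices p) × (z ∈ walkVertices p)

  IsGeneralPosition : List V → Set
  IsGeneralPosition S = Unique S ×
    (∀ x y z → x ∈ S → y ∈ S → z ∈ S → x ≢ y → y ≢ z → x ≢ z →
       ¬ OnCommonGeodesic x y z)

  GpNumberIs : ℕ → Set
  GpNumberIs m =
    (Σ (List V) λ S → IsGeneralPosition S × length S ≡ m) ×
    (∀ S → IsGeneralPosition S → length S ≤ m)

-- The theta graph Θ(k, ℓ): vertices A, B and, for each path i < k,
-- internal vertices inner i j (j < ℓ - 1) at distance j+1 from A along path i.

data ThetaV (k ℓ : ℕ) : Set where
  vA vB : ThetaV k ℓ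
  inner : Fin k → Fin (ℓ ∸ 1) → ThetaV k ℓ

data ThetaAdj (k ℓ : ℕ) : ThetaV k ℓ → ThetaV k ℓ → Set where
  A-first : ∀ i j → toℕ j ≡ 0 → ThetaAdj k ℓ vA (inner i j)
  first-A : ∀ i j → toℕ j ≡ 0 → ThetaAdj k ℓ (inner i j) vA
  B-last  : ∀ i j → toℕ j ≡ ℓ ∸ 2 → ThetaAdj k ℓ vB (inner i j)
  last-B  : ∀ i j → toℕ j ≡ ℓ ∸ 2 → ThetaAdj k ℓ (inner i j) vB
  step-up   : ∀ i j j′ → toℕ j′ ≡ suc (toℕ j) → ThetaAdj k ℓ (inner i j) (inner i j′)
  step-down : ∀ i j j′ → toℕ j ≡ suc (toℕ j′) → ThetaAdj k ℓ (inner i j) (inner i j′)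

-- Every A–B path of Θ(k, ℓ) is a geodesic, so a general position set S contains at most two of
-- its vertices, ends included. If two different paths each carried two inner vertices of S, the
-- shorter of the two routes between them, through A or through B, would be a geodesic through
-- three of them. Label each vertex by its path, A and B sharing one extra label. If no two
-- vertices of S share a label, |S| ≤ k + 1; if A, B ∈ S, then S = {A, B}; otherwise two inner
-- vertices of S lie on one path i, so A, B ∉ S, path i carries no third vertex of S and every
-- other path at most one, and moving one of the two to the unused extra label makes the
-- labelling injective on S. Conversely, for ℓ ≥ 3, B together with the k neighbours of A is in
-- general position: any two neighbours of A are joined by a walk of length 2 through A, while B
-- is at distance ℓ − 1 ≥ 2 from each of them, so none of these vertices lies on a geodesic
-- between two others. Geodesics are recognised through an explicit distance function that
-- changes by at most one along each edge and hence bounds the length of every walk from below.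

module Submission where

open import Defs
open import Data.Empty using (⊥; ⊥-elim)
open import Data.Nat using (ℕ; zero; suc; _+_; _∸_; _⊓_; ∣_-_∣; _≤_; _<_; z≤n; s≤s; s≤s⁻¹)
open import Data.Nat.Properties
import Data.Fin as Fin
open import Data.Fin using (Fin; toℕ)
import Data.Fin.Properties as Finₚ
open import Data.List using (List; []; _∷_; length; lookup; tabulate)
open import Data.List.Properties using (length-tabulate)
open import Data.List.Membership.Propositional using (_∈_; _∉_; find; lose)
open import Data.List.Membership.Propositional.Properties using (∈-lookup; ∈-tabulate⁻)
open import Data.List.Relation.Unary.Any using (here; there; any?)
import Data.List.Relation.Unary.All as All
import Data.List.Relation.Unary.All.Properties as Allₚ
open import Data.List.Relation.Unary.AllPairs using (_∷_)
open import Data.List.Relation.Unary.Unique.Propositional using (Unique)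
import Data.List.Relation.Unary.Unique.Propositional.Properties as Uniqueₚ
open import Data.Product using (_,_; ∃; ∃₂; proj₁; proj₂)
open import Data.Sum using (_⊎_; inj₁; inj₂)
import Data.Sum as Sum
open import Function using (_∘_)
open import Relation.Binary.Definitions using (Symmetric; DecidableEquality)
open import Relation.Binary.PropositionalEquality
open import Relation.Nullary using (¬_; Dec; yes; no; ¬?; _×-dec_)

Unique-lookup-injective : ∀ {A : Set} {xs : List A} → Unique xs →
                          ∀ i j → lookup xs i ≡ lookup xs j → i ≡ j
Unique-lookup-injective (_ ∷ _) Fin.zero Fin.zero _ = refl
Unique-lookup-injective (x∉ ∷ _) Fin.zero (Fin.suc j) eq = ⊥-elim (All.lookup x∉ (∈-lookup j) eq)
Unique-lookup-injective (x∉ ∷ _) (Fin.suc i) Fin.zero eq = ⊥-elim (All.lookup x∉ (∈-lookup i) (sym eq))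
Unique-lookup-injective (_ ∷ u) (Fin.suc i) (Fin.suc j) eq = cong Fin.suc (Unique-lookup-injective u i j eq)

Unique⇒length≤ : ∀ {A : Set} {n} {xs : List A} → Unique xs → (f : A → Fin n) →
                 (∀ {x y} → x ∈ xs → y ∈ xs → f x ≡ f y → x ≡ y) → length xs ≤ n
Unique⇒length≤ u f f-inj = Finₚ.injective⇒≤ λ {i} {j} eq →
  Unique-lookup-injective u i j (f-inj (∈-lookup i) (∈-lookup j) eq)

m∸n≤1+m∸[1+n] : ∀ m n → m ∸ n ≤ suc (m ∸ suc n)
m∸n≤1+m∸[1+n] zero zero = z≤n
m∸n≤1+m∸[1+n] zero (suc n) = z≤n
m∸n≤1+m∸[1+n] (suc m) zero = ≤-refl
m∸n≤1+m∸[1+n] (suc m) (suc n) = m∸n≤1+m∸[1+n] m n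

m∸[1+n]≤1+m∸n : ∀ m n → m ∸ suc n ≤ suc (m ∸ n)
m∸[1+n]≤1+m∸n m n = ≤-trans (∸-monoʳ-≤ m (n≤1+n n)) (n≤1+n _)

∣m-n∣≤1+∣1+m-n∣ : ∀ m n → ∣ m - n ∣ ≤ suc ∣ suc m - n ∣
∣m-n∣≤1+∣1+m-n∣ zero zero = z≤n
∣m-n∣≤1+∣1+m-n∣ zero (suc n) = ≤-refl
∣m-n∣≤1+∣1+m-n∣ (suc m) zero = ≤-trans (n≤1+n _) (n≤1+n _)
∣m-n∣≤1+∣1+m-n∣ (suc m) (suc n) = ∣m-n∣≤1+∣1+m-n∣ m n

∣1+m-n∣≤1+∣m-n∣ : ∀ m n → ∣ suc m - n ∣ ≤ suc ∣ m - n ∣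
∣1+m-n∣≤1+∣m-n∣ zero zero = ≤-refl
∣1+m-n∣≤1+∣m-n∣ zero (suc n) = ≤-trans (n≤1+n n) (n≤1+n _)
∣1+m-n∣≤1+∣m-n∣ (suc m) zero = ≤-refl
∣1+m-n∣≤1+∣m-n∣ (suc m) (suc n) = ∣1+m-n∣≤1+∣m-n∣ m n

1+m∸n≤1+∣m-n∣ : ∀ m n → suc m ∸ n ≤ suc ∣ m - n ∣
1+m∸n≤1+∣m-n∣ m zero = ≤-reflexive (cong suc (sym (∣-∣-identityʳ m)))
1+m∸n≤1+∣m-n∣ zero (suc n) = ≤-trans (≤-reflexive (0∸n≡0 n)) z≤n
1+m∸n≤1+∣m-n∣ (suc m) (suc n) = 1+m∸n≤1+∣m-n∣ m n

module _ {V : Set} {E : V → V → Set} where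

  private
    variable
      a b c u v w x y z : V

  infixr 5 _++ʷ_
  _++ʷ_ : Walk E u w → Walk E w v → Walk E u v
  [] ++ʷ q = q
  (e ∷ p) ++ʷ q = e ∷ (p ++ʷ q)

  ++ʷ-assoc : (p : Walk E u w) (q : Walk E w x) (r : Walk E x v) →
              (p ++ʷ q) ++ʷ r ≡ p ++ʷ (q ++ʷ r)
  ++ʷ-assoc [] q r = refl
  ++ʷ-assoc (e ∷ p) q r = cong (e ∷_) (++ʷ-assoc p q r)

  walkLength-++ʷ : (p : Walk E u w) (q : Walk E w v) →
                   walkLength E (p ++ʷ q) ≡ walkLength E p + walkLength E q
  walkLength-++ʷ [] q = refl
  walkLength-++ʷ (e ∷ p) q = cong suc (walkLength-++ʷ p q)

  start∈walkVertices : (p : Walk E u v) → u ∈ walkVertices E p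
  start∈walkVertices [] = here refl
  start∈walkVertices (e ∷ p) = here refl

  end∈walkVertices : (p : Walk E u v) → v ∈ walkVertices E p
  end∈walkVertices [] = here refl
  end∈walkVertices (e ∷ p) = there (end∈walkVertices p)

  ∈-++ʷ⁺ˡ : (p : Walk E u w) (q : Walk E w v) → x ∈ walkVertices E p → x ∈ walkVertices E (p ++ʷ q)
  ∈-++ʷ⁺ˡ [] q (here refl) = start∈walkVertices q
  ∈-++ʷ⁺ˡ (e ∷ p) q (here refl) = here refl
  ∈-++ʷ⁺ˡ (e ∷ p) q (there x∈p) = there (∈-++ʷ⁺ˡ p q x∈p)

  ∈-++ʷ⁺ʳ : (p : Walk E u w) (q : Walk E w v) → x ∈ walkVertices E q → x ∈ walkVertices E (p ++ʷ q)
  ∈-++ʷ⁺ʳ [] q x∈q = x∈q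
  ∈-++ʷ⁺ʳ (e ∷ p) q x∈q = there (∈-++ʷ⁺ʳ p q x∈q)

  ∈-++ʷ⁻ : (p : Walk E u w) (q : Walk E w v) → x ∈ walkVertices E (p ++ʷ q) →
           x ∈ walkVertices E p ⊎ x ∈ walkVertices E q
  ∈-++ʷ⁻ [] q x∈q = inj₂ x∈q
  ∈-++ʷ⁻ (e ∷ p) q (here refl) = inj₁ (here refl)
  ∈-++ʷ⁻ (e ∷ p) q (there x∈) = Sum.map₁ there (∈-++ʷ⁻ p q x∈)

  split : (p : Walk E u v) → x ∈ walkVertices E p →
          ∃₂ λ (p₁ : Walk E u x) (p₂ : Walk E x v) → p ≡ p₁ ++ʷ p₂
  split [] (here refl) = [] , [] , refl
  split (e ∷ p) (here refl) = [] , e ∷ p , refl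
  split (e ∷ p) (there x∈p) with split p x∈p
  ... | p₁ , p₂ , refl = e ∷ p₁ , p₂ , refl

  module _ (E-sym : Symmetric E) where

    reverseʷ : Walk E u v → Walk E v u
    reverseʷ [] = []
    reverseʷ (e ∷ p) = reverseʷ p ++ʷ (E-sym e ∷ [])

    walkLength-reverseʷ : (p : Walk E u v) → walkLength E (reverseʷ p) ≡ walkLength E p
    walkLength-reverseʷ [] = refl
    walkLength-reverseʷ (e ∷ p) = begin
      walkLength E (reverseʷ p ++ʷ (E-sym e ∷ []))  ≡⟨ walkLength-++ʷ (reverseʷ p) _ ⟩
      walkLength E (reverseʷ p) + 1                  ≡⟨ +-comm _ 1 ⟩
      suc (walkLength E (reverseʷ p))                ≡⟨ cong suc (walkLength-reverseʷ p) ⟩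
      suc (walkLength E p)                           ∎
      where open ≡-Reasoning

    ∈-reverseʷ⁺ : (p : Walk E u v) → x ∈ walkVertices E p → x ∈ walkVertices E (reverseʷ p)
    ∈-reverseʷ⁺ [] x∈p = x∈p
    ∈-reverseʷ⁺ (e ∷ p) (here refl) = ∈-++ʷ⁺ʳ (reverseʷ p) _ (end∈walkVertices (E-sym e ∷ []))
    ∈-reverseʷ⁺ (e ∷ p) (there x∈p) = ∈-++ʷ⁺ˡ (reverseʷ p) _ (∈-reverseʷ⁺ p x∈p)

  IsGeodesic-++ʷ⁻ˡ : (p : Walk E u w) (q : Walk E w v) → IsGeodesic E (p ++ʷ q) → IsGeodesic E p
  IsGeodesic-++ʷ⁻ˡ p q geo p′ = +-cancelʳ-≤ (walkLength E q) _ _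
    (subst₂ _≤_ (walkLength-++ʷ p q) (walkLength-++ʷ p′ q) (geo (p′ ++ʷ q)))

  IsGeodesic-++ʷ⁻ʳ : (p : Walk E u w) (q : Walk E w v) → IsGeodesic E (p ++ʷ q) → IsGeodesic E q
  IsGeodesic-++ʷ⁻ʳ p q geo q′ = +-cancelˡ-≤ (walkLength E p) _ _
    (subst₂ _≤_ (walkLength-++ʷ p q) (walkLength-++ʷ p q′) (geo (p ++ʷ q′)))

  Between : V → V → V → Set
  Between a b c = ∃₂ λ (p : Walk E a b) (q : Walk E b c) → IsGeodesic E (p ++ʷ q)

  IsGeodesic⇒Between-end : (g : Walk E u x) → IsGeodesic E g →
    y ∈ walkVertices E g → z ∈ walkVertices E g → Between y z x ⊎ Between z y x
  IsGeodesic⇒Between-end g geo y∈g z∈g with split g y∈g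
  ... | g₁ , g₂ , refl with ∈-++ʷ⁻ g₁ g₂ z∈g
  ...   | inj₂ z∈g₂ with split g₂ z∈g₂
  ...     | h₁ , h₂ , refl = inj₁ (h₁ , h₂ , IsGeodesic-++ʷ⁻ʳ g₁ _ geo)
  IsGeodesic⇒Between-end g geo y∈g z∈g | g₁ , g₂ , refl | inj₁ z∈g₁ with split g₁ z∈g₁
  ...     | h₁ , h₂ , refl =
    inj₂ (h₂ , g₂ , IsGeodesic-++ʷ⁻ʳ h₁ _ (subst (IsGeodesic E) (++ʷ-assoc h₁ h₂ g₂) geo))

  IsGeodesic⇒Between-start : (g : Walk E x v) → IsGeodesic E g →
    y ∈ walkVertices E g → z ∈ walkVertices E g → Between x y z ⊎ Between x z y
  IsGeodesic⇒Between-start g geo y∈g z∈g with split g y∈g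
  ... | g₁ , g₂ , refl with ∈-++ʷ⁻ g₁ g₂ z∈g
  ...   | inj₁ z∈g₁ with split g₁ z∈g₁
  ...     | h₁ , h₂ , refl = inj₂ (h₁ , h₂ , IsGeodesic-++ʷ⁻ˡ _ g₂ geo)
  IsGeodesic⇒Between-start g geo y∈g z∈g | g₁ , g₂ , refl | inj₂ z∈g₂ with split g₂ z∈g₂
  ...     | h₁ , h₂ , refl =
    inj₁ (g₁ , h₁ , IsGeodesic-++ʷ⁻ˡ _ h₂ (subst (IsGeodesic E) (sym (++ʷ-assoc g₁ h₁ h₂)) geo))

  IsGeodesic-++ʷ⇒Between : (p : Walk E u x) (q : Walk E x v) → IsGeodesic E (p ++ʷ q) →
    y ∈ walkVertices E p → z ∈ walkVertices E q → Between y x z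
  IsGeodesic-++ʷ⇒Between p q geo y∈p z∈q with split p y∈p | split q z∈q
  ... | a₁ , a₂ , refl | b₁ , b₂ , refl =
    a₂ , b₁ , IsGeodesic-++ʷ⁻ˡ _ b₂ (IsGeodesic-++ʷ⁻ʳ a₁ _ (subst (IsGeodesic E) reassociate geo))
    where
      reassociate : (a₁ ++ʷ a₂) ++ʷ (b₁ ++ʷ b₂) ≡ a₁ ++ʷ ((a₂ ++ʷ b₁) ++ʷ b₂)
      reassociate = trans (++ʷ-assoc a₁ a₂ _) (cong (a₁ ++ʷ_) (sym (++ʷ-assoc a₂ b₁ b₂)))

  OnCommonGeodesic⇒Between : OnCommonGeodesic E x y z →
    Between y x z ⊎ Between z x y ⊎ (Between y z x ⊎ Between z y x) ⊎ (Between x y z ⊎ Between x z y)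
  OnCommonGeodesic⇒Between (_ , _ , g , geo , x∈g , y∈g , z∈g) with split g x∈g
  ... | p , q , refl with ∈-++ʷ⁻ p q y∈g | ∈-++ʷ⁻ p q z∈g
  ... | inj₁ y∈p | inj₂ z∈q = inj₁ (IsGeodesic-++ʷ⇒Between p q geo y∈p z∈q)
  ... | inj₂ y∈q | inj₁ z∈p = inj₂ (inj₁ (IsGeodesic-++ʷ⇒Between p q geo z∈p y∈q))
  ... | inj₁ y∈p | inj₁ z∈p =
    inj₂ (inj₂ (inj₁ (IsGeodesic⇒Between-end p (IsGeodesic-++ʷ⁻ˡ p q geo) y∈p z∈p)))
  ... | inj₂ y∈q | inj₂ z∈q =
    inj₂ (inj₂ (inj₂ (IsGeodesic⇒Between-start q (IsGeodesic-++ʷ⁻ʳ p q geo) y∈q z∈q)))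

  betweenFree⇒IsGeneralPosition : ∀ {S} → Unique S →
    (∀ {a b c} → a ∈ S → b ∈ S → c ∈ S → a ≢ b → b ≢ c → a ≢ c → ¬ Between a b c) →
    IsGeneralPosition E S
  betweenFree⇒IsGeneralPosition {S} uniq free = uniq , noTriple
    where
      noTriple : ∀ x y z → x ∈ S → y ∈ S → z ∈ S → x ≢ y → y ≢ z → x ≢ z → ¬ OnCommonGeodesic E x y z
      noTriple x y z x∈ y∈ z∈ x≢y y≢z x≢z common with OnCommonGeodesic⇒Between common
      ... | inj₁ yxz = free y∈ x∈ z∈ (≢-sym x≢y) x≢z y≢z yxz
      ... | inj₂ (inj₁ zxy) = free z∈ x∈ y∈ (≢-sym x≢z) x≢y (≢-sym y≢z) zxy
      ... | inj₂ (inj₂ (inj₁ (inj₁ yzx))) = free y∈ z∈ x∈ y≢z (≢-sym x≢z) (≢-sym x≢y) yzx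
      ... | inj₂ (inj₂ (inj₁ (inj₂ zyx))) = free z∈ y∈ x∈ (≢-sym y≢z) (≢-sym x≢y) (≢-sym x≢z) zyx
      ... | inj₂ (inj₂ (inj₂ (inj₁ xyz))) = free x∈ y∈ z∈ x≢y y≢z x≢z xyz
      ... | inj₂ (inj₂ (inj₂ (inj₂ xzy))) = free x∈ z∈ y∈ x≢z (≢-sym y≢z) x≢y xzy

  module DistanceLowerBound (d : V → V → ℕ) (d-refl : ∀ v → d v v ≡ 0)
                            (d-step : ∀ {u w} → E u w → ∀ v → d u v ≤ suc (d w v)) where

    d≤walkLength : (p : Walk E u v) → d u v ≤ walkLength E p
    d≤walkLength {u} [] = ≤-reflexive (d-refl u)
    d≤walkLength {v = v} (e ∷ p) = ≤-trans (d-step e v) (s≤s (d≤walkLength p))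

    walkLength≡d⇒IsGeodesic : (p : Walk E u v) → walkLength E p ≡ d u v → IsGeodesic E p
    walkLength≡d⇒IsGeodesic p p≡d q = ≤-trans (≤-reflexive p≡d) (d≤walkLength q)

    walkLength≡d⇒OnCommonGeodesic : (p : Walk E u v) → walkLength E p ≡ d u v →
      x ∈ walkVertices E p → y ∈ walkVertices E p → z ∈ walkVertices E p → OnCommonGeodesic E x y z
    walkLength≡d⇒OnCommonGeodesic p p≡d x∈p y∈p z∈p =
      _ , _ , p , walkLength≡d⇒IsGeodesic p p≡d , x∈p , y∈p , z∈p

    shortcut⇒¬Between : (r : Walk E a c) → walkLength E r < d a b + d b c → ¬ Between a b c
    shortcut⇒¬Between r r<d+d (p , q , geo) = <⇒≱ r<d+d (begin
      d _ _ + d _ _                     ≤⟨ +-mono-≤ (d≤walkLength p) (d≤walkLength q) ⟩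
      walkLength E p + walkLength E q   ≡⟨ walkLength-++ʷ p q ⟨
      walkLength E (p ++ʷ q)            ≤⟨ geo r ⟩
      walkLength E r                    ∎)
      where open ≤-Reasoning

-- Θ(1 + k′, 2 + n), so each path has n + 1 inner vertices; only the lower bound needs n ≥ 1.
module ThetaGraph (k′ n : ℕ) where

  k ℓ : ℕ
  k = suc k′
  ℓ = suc (suc n)

  V : Set
  V = ThetaV k ℓ

  E : V → V → Set
  E = ThetaAdj k ℓ

  -- the shorter of the routes through A and through B
  crossDist : ℕ → ℕ → ℕ
  crossDist a b = (suc a + suc b) ⊓ ((suc n ∸ a) + (suc n ∸ b))

  innerDist : {i i′ : Fin k} → Dec (i ≡ i′) → ℕ → ℕ → ℕ
  innerDist (yes _) a b = ∣ a - b ∣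
  innerDist (no _) a b = crossDist a b

  dist : V → V → ℕ
  dist vA vA = 0
  dist vA vB = ℓ
  dist vA (inner i j) = suc (toℕ j)
  dist vB vA = ℓ
  dist vB vB = 0
  dist vB (inner i j) = suc n ∸ toℕ j
  dist (inner i j) vA = suc (toℕ j)
  dist (inner i j) vB = suc n ∸ toℕ j
  dist (inner i j) (inner i′ j′) = innerDist (i Fin.≟ i′) (toℕ j) (toℕ j′)

  dist-refl : ∀ v → dist v v ≡ 0
  dist-refl vA = refl
  dist-refl vB = refl
  dist-refl (inner i j) with i Fin.≟ i
  ... | yes _ = ∣n-n∣≡0 (toℕ j)
  ... | no i≢i = ⊥-elim (i≢i refl)

  dist-otherPath : ∀ {i i′} j j′ → i ≢ i′ →
                   dist (inner i j) (inner i′ j′) ≡ crossDist (toℕ j) (toℕ j′)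
  dist-otherPath {i} {i′} j j′ i≢i′ with i Fin.≟ i′
  ... | yes i≡i′ = ⊥-elim (i≢i′ i≡i′)
  ... | no _ = refl

  crossDist-stepUp : ∀ a b → crossDist a b ≤ suc (crossDist (suc a) b)
  crossDist-stepUp a b =
    ⊓-mono-≤ (≤-trans (n≤1+n _) (n≤1+n _)) (+-monoˡ-≤ (suc n ∸ b) (m∸n≤1+m∸[1+n] (suc n) a))

  crossDist-stepDown : ∀ a b → crossDist (suc a) b ≤ suc (crossDist a b)
  crossDist-stepDown a b = ⊓-mono-≤ ≤-refl (+-monoˡ-≤ (suc n ∸ b) (m∸[1+n]≤1+m∸n (suc n) a))

  dist-A-first : ∀ i j → toℕ j ≡ 0 → ∀ v → dist vA v ≤ suc (dist (inner i j) v)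
  dist-A-first i j j≡0 vA = z≤n
  dist-A-first i j j≡0 vB rewrite j≡0 = ≤-refl
  dist-A-first i j j≡0 (inner i′ j′) rewrite j≡0 with i Fin.≟ i′
  ... | yes _ = ≤-refl
  ... | no _ = s≤s (⊓-glb (≤-trans (n≤1+n _) (n≤1+n _))
                          (≤-trans (<⇒≤ (Finₚ.toℕ<n j′)) (m≤m+n (suc n) (suc n ∸ toℕ j′))))

  dist-first-A : ∀ i j → toℕ j ≡ 0 → ∀ v → dist (inner i j) v ≤ suc (dist vA v)
  dist-first-A i j j≡0 vA rewrite j≡0 = ≤-refl
  dist-first-A i j j≡0 vB = ≤-trans (m∸n≤m (suc n) (toℕ j)) (≤-trans (n≤1+n _) (n≤1+n _))
  dist-first-A i j j≡0 (inner i′ j′) rewrite j≡0 with i Fin.≟ i′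
  ... | yes _ = ≤-trans (n≤1+n _) (n≤1+n _)
  ... | no _ = m⊓n≤m _ _

  dist-B-last : ∀ i j → toℕ j ≡ n → ∀ v → dist vB v ≤ suc (dist (inner i j) v)
  dist-B-last i j j≡n vA rewrite j≡n = ≤-refl
  dist-B-last i j j≡n vB = z≤n
  dist-B-last i j j≡n (inner i′ j′) rewrite j≡n with i Fin.≟ i′
  ... | yes _ = 1+m∸n≤1+∣m-n∣ n (toℕ j′)
  ... | no _ = ⊓-glb (≤-trans (m∸n≤m (suc n) (toℕ j′))
                              (≤-trans (m≤m+n (suc n) (suc (toℕ j′))) (n≤1+n _)))
                     (≤-trans (m≤n+m _ _) (n≤1+n _))

  dist-last-B : ∀ i j → toℕ j ≡ n → ∀ v → dist (inner i j) v ≤ suc (dist vB v)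
  dist-last-B i j j≡n vA rewrite j≡n = ≤-trans (n≤1+n _) (n≤1+n _)
  dist-last-B i j j≡n vB rewrite j≡n = ≤-reflexive (m+n∸n≡m 1 n)
  dist-last-B i j j≡n (inner i′ j′) rewrite j≡n with i Fin.≟ i′
  ... | yes _ = ≤-trans (≤-reflexive (m≤n⇒∣n-m∣≡n∸m (Finₚ.toℕ≤pred[n] j′)))
                        (≤-trans (∸-monoˡ-≤ (toℕ j′) (n≤1+n n)) (n≤1+n _))
  ... | no _ = ≤-trans (m⊓n≤n _ _) (≤-reflexive (cong (_+ (suc n ∸ toℕ j′)) (m+n∸n≡m 1 n)))

  dist-step-up : ∀ i j j′ → toℕ j′ ≡ suc (toℕ j) →
                 ∀ v → dist (inner i j) v ≤ suc (dist (inner i j′) v)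
  dist-step-up i j j′ j′≡1+j vA rewrite j′≡1+j = ≤-trans (n≤1+n _) (n≤1+n _)
  dist-step-up i j j′ j′≡1+j vB rewrite j′≡1+j = m∸n≤1+m∸[1+n] (suc n) (toℕ j)
  dist-step-up i j j′ j′≡1+j (inner i′ j″) rewrite j′≡1+j with i Fin.≟ i′
  ... | yes _ = ∣m-n∣≤1+∣1+m-n∣ (toℕ j) (toℕ j″)
  ... | no _ = crossDist-stepUp (toℕ j) (toℕ j″)

  dist-step-down : ∀ i j j′ → toℕ j ≡ suc (toℕ j′) →
                   ∀ v → dist (inner i j) v ≤ suc (dist (inner i j′) v)
  dist-step-down i j j′ j≡1+j′ vA rewrite j≡1+j′ = ≤-refl
  dist-step-down i j j′ j≡1+j′ vB rewrite j≡1+j′ = m∸[1+n]≤1+m∸n (suc n) (toℕ j′)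
  dist-step-down i j j′ j≡1+j′ (inner i′ j″) rewrite j≡1+j′ with i Fin.≟ i′
  ... | yes _ = ∣1+m-n∣≤1+∣m-n∣ (toℕ j′) (toℕ j″)
  ... | no _ = crossDist-stepDown (toℕ j′) (toℕ j″)

  dist-step : ∀ {u w} → E u w → ∀ v → dist u v ≤ suc (dist w v)
  dist-step (A-first i j j≡0) = dist-A-first i j j≡0
  dist-step (first-A i j j≡0) = dist-first-A i j j≡0
  dist-step (B-last i j j≡n) = dist-B-last i j j≡n
  dist-step (last-B i j j≡n) = dist-last-B i j j≡n
  dist-step (step-up i j j′ eq) = dist-step-up i j j′ eq
  dist-step (step-down i j j′ eq) = dist-step-down i j j′ eq

  open DistanceLowerBound {E = E} dist dist-refl dist-step

  E-sym : Symmetric E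
  E-sym (A-first i j j≡0) = first-A i j j≡0
  E-sym (first-A i j j≡0) = A-first i j j≡0
  E-sym (B-last i j j≡n) = last-B i j j≡n
  E-sym (last-B i j j≡n) = B-last i j j≡n
  E-sym (step-up i j j′ eq) = step-down i j′ j eq
  E-sym (step-down i j j′ eq) = step-up i j′ j eq

  ascend : ∀ i d (j : Fin (suc n)) → toℕ j + d ≡ n → Walk E (inner i j) vB
  ascend i zero j j+0≡n = last-B i j (trans (sym (+-identityʳ _)) j+0≡n) ∷ []
  ascend i (suc d) j j+1+d≡n = step-up i j j⁺ (Finₚ.toℕ-fromℕ< j⁺<1+n) ∷ ascend i d j⁺ j⁺+d≡n
    where
      1+j+d≡n : suc (toℕ j) + d ≡ n
      1+j+d≡n = trans (sym (+-suc _ d)) j+1+d≡n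
      j⁺<1+n : suc (toℕ j) < suc n
      j⁺<1+n = s≤s (≤-trans (m≤m+n _ d) (≤-reflexive 1+j+d≡n))
      j⁺ : Fin (suc n)
      j⁺ = Fin.fromℕ< j⁺<1+n
      j⁺+d≡n : toℕ j⁺ + d ≡ n
      j⁺+d≡n = trans (cong (_+ d) (Finₚ.toℕ-fromℕ< j⁺<1+n)) 1+j+d≡n

  descend : ∀ i d (j : Fin (suc n)) → toℕ j ≡ d → Walk E (inner i j) vA
  descend i zero j j≡0 = first-A i j j≡0 ∷ []
  descend i (suc d) j j≡1+d =
    step-down i j j⁻ (trans j≡1+d (cong suc (sym j⁻≡d))) ∷ descend i d j⁻ j⁻≡d
    where
      d<1+n : d < suc n
      d<1+n = <-trans (n<1+n d) (subst (_< suc n) j≡1+d (Finₚ.toℕ<n j))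
      j⁻ : Fin (suc n)
      j⁻ = Fin.fromℕ< d<1+n
      j⁻≡d : toℕ j⁻ ≡ d
      j⁻≡d = Finₚ.toℕ-fromℕ< d<1+n

  walkLength-ascend : ∀ i d j j+d≡n → walkLength E (ascend i d j j+d≡n) ≡ suc d
  walkLength-ascend i zero j _ = refl
  walkLength-ascend i (suc d) j _ = cong suc (walkLength-ascend i d _ _)

  walkLength-descend : ∀ i d j j≡d → walkLength E (descend i d j j≡d) ≡ suc d
  walkLength-descend i zero j _ = refl
  walkLength-descend i (suc d) j _ = cong suc (walkLength-descend i d _ _)

  ∈-ascend : ∀ i d j j+d≡n {j′} → toℕ j ≤ toℕ j′ →
             inner i j′ ∈ walkVertices E (ascend i d j j+d≡n)
  ∈-ascend i zero j j+0≡n {j′} j≤j′ = here (cong (inner i) (Finₚ.toℕ-injective j′≡j))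
    where
      j′≡j : toℕ j′ ≡ toℕ j
      j′≡j = ≤-antisym (≤-trans (Finₚ.toℕ≤pred[n] j′) (≤-reflexive (trans (sym j+0≡n) (+-identityʳ _))))
                       j≤j′
  ∈-ascend i (suc d) j _ {j′} j≤j′ with m≤n⇒m<n∨m≡n j≤j′
  ... | inj₂ j≡j′ = here (cong (inner i) (Finₚ.toℕ-injective (sym j≡j′)))
  ... | inj₁ j<j′ = there (∈-ascend i d _ _ (≤-trans (≤-reflexive (Finₚ.toℕ-fromℕ< j⁺<1+n)) j<j′))
    where
      j⁺<1+n : suc (toℕ j) < suc n
      j⁺<1+n = ≤-trans (s≤s j<j′) (Finₚ.toℕ<n j′)

  ∈-descend : ∀ i d j j≡d {j′} → toℕ j′ ≤ d →
              inner i j′ ∈ walkVertices E (descend i d j j≡d)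
  ∈-descend i zero j j≡0 j′≤0 =
    here (cong (inner i) (Finₚ.toℕ-injective (trans (n≤0⇒n≡0 j′≤0) (sym j≡0))))
  ∈-descend i (suc d) j j≡1+d j′≤1+d with m≤n⇒m<n∨m≡n j′≤1+d
  ... | inj₂ j′≡1+d = here (cong (inner i) (Finₚ.toℕ-injective (trans j′≡1+d (sym j≡1+d))))
  ... | inj₁ j′<1+d = there (∈-descend i d _ _ (s≤s⁻¹ j′<1+d))

  toB : ∀ i j → Walk E (inner i j) vB
  toB i j = ascend i (n ∸ toℕ j) j (m+[n∸m]≡n (Finₚ.toℕ≤pred[n] j))

  toA : ∀ i j → Walk E (inner i j) vA
  toA i j = descend i (toℕ j) j refl

  walkLength-toB : ∀ i j → walkLength E (toB i j) ≡ suc n ∸ toℕ j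
  walkLength-toB i j = trans (walkLength-ascend i _ j _) (sym (+-∸-assoc 1 (Finₚ.toℕ≤pred[n] j)))

  walkLength-toA : ∀ i j → walkLength E (toA i j) ≡ suc (toℕ j)
  walkLength-toA i j = walkLength-descend i (toℕ j) j refl

  ∈-toB : ∀ i {j j′} → toℕ j ≤ toℕ j′ → inner i j′ ∈ walkVertices E (toB i j)
  ∈-toB i {j} = ∈-ascend i _ j _

  ∈-toA : ∀ i {j j′} → toℕ j′ ≤ toℕ j → inner i j′ ∈ walkVertices E (toA i j)
  ∈-toA i {j} = ∈-descend i _ j refl

  thetaPath : Fin k → Walk E vA vB
  thetaPath i = A-first i Fin.zero refl ∷ toB i Fin.zero

  inner∈thetaPath : ∀ i j → inner i j ∈ walkVertices E (thetaPath i)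
  inner∈thetaPath i j = there (∈-toB i z≤n)

  thetaPath⇒OnCommonGeodesic : ∀ i {x y z} → x ∈ walkVertices E (thetaPath i) →
    y ∈ walkVertices E (thetaPath i) → z ∈ walkVertices E (thetaPath i) → OnCommonGeodesic E x y z
  thetaPath⇒OnCommonGeodesic i =
    walkLength≡d⇒OnCommonGeodesic (thetaPath i) (cong suc (walkLength-toB i Fin.zero))

  -- The shorter route from inner i a to inner i′ b′ passes a′ if it goes through B, and b if through A.
  twoPaths⇒OnCommonGeodesic : ∀ {i i′ a a′ b b′} → i ≢ i′ → toℕ a ≤ toℕ a′ → toℕ b ≤ toℕ b′ →
    OnCommonGeodesic E (inner i a) (inner i a′) (inner i′ b′) ⊎
    OnCommonGeodesic E (inner i a) (inner i′ b) (inner i′ b′)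
  twoPaths⇒OnCommonGeodesic {i} {i′} {a} {a′} {b} {b′} i≢i′ a≤a′ b≤b′
    with ≤-total ((suc n ∸ toℕ a) + (suc n ∸ toℕ b′)) (suc (toℕ a) + suc (toℕ b′))
  ... | inj₁ viaB≤viaA = inj₁ (walkLength≡d⇒OnCommonGeodesic viaB viaB-shortest
          (start∈walkVertices viaB) (∈-++ʷ⁺ˡ (toB i a) _ (∈-toB i a≤a′)) (end∈walkVertices viaB))
    where
      viaB : Walk E (inner i a) (inner i′ b′)
      viaB = toB i a ++ʷ reverseʷ E-sym (toB i′ b′)
      viaB-shortest : walkLength E viaB ≡ dist (inner i a) (inner i′ b′)
      viaB-shortest = begin
        walkLength E viaB                   ≡⟨ walkLength-++ʷ (toB i a) _ ⟩
        walkLength E (toB i a) + walkLength E (reverseʷ E-sym (toB i′ b′))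
          ≡⟨ cong₂ _+_ (walkLength-toB i a) (trans (walkLength-reverseʷ E-sym _) (walkLength-toB i′ b′)) ⟩
        (suc n ∸ toℕ a) + (suc n ∸ toℕ b′)  ≡⟨ m≥n⇒m⊓n≡n viaB≤viaA ⟨
        crossDist (toℕ a) (toℕ b′)          ≡⟨ dist-otherPath a b′ i≢i′ ⟨
        dist (inner i a) (inner i′ b′)      ∎
        where open ≡-Reasoning
  ... | inj₂ viaA≤viaB = inj₂ (walkLength≡d⇒OnCommonGeodesic viaA viaA-shortest
          (start∈walkVertices viaA) (∈-++ʷ⁺ʳ (toA i a) _ (∈-reverseʷ⁺ E-sym _ (∈-toA i′ b≤b′)))
          (end∈walkVertices viaA))
    where
      viaA : Walk E (inner i a) (inner i′ b′)
      viaA = toA i a ++ʷ reverseʷ E-sym (toA i′ b′)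
      viaA-shortest : walkLength E viaA ≡ dist (inner i a) (inner i′ b′)
      viaA-shortest = begin
        walkLength E viaA                ≡⟨ walkLength-++ʷ (toA i a) _ ⟩
        walkLength E (toA i a) + walkLength E (reverseʷ E-sym (toA i′ b′))
          ≡⟨ cong₂ _+_ (walkLength-toA i a) (trans (walkLength-reverseʷ E-sym _) (walkLength-toA i′ b′)) ⟩
        suc (toℕ a) + suc (toℕ b′)       ≡⟨ m≤n⇒m⊓n≡m viaA≤viaB ⟨
        crossDist (toℕ a) (toℕ b′)       ≡⟨ dist-otherPath a b′ i≢i′ ⟨
        dist (inner i a) (inner i′ b′)   ∎
        where open ≡-Reasoning

  inner≢inner : ∀ {i i′ : Fin k} {j j′ : Fin (suc n)} → i ≢ i′ →
                _≢_ {A = V} (inner i j) (inner i′ j′)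
  inner≢inner i≢i′ refl = i≢i′ refl

  _≟ᵥ_ : DecidableEquality V
  vA ≟ᵥ vA = yes refl
  vA ≟ᵥ vB = no λ ()
  vA ≟ᵥ inner _ _ = no λ ()
  vB ≟ᵥ vA = no λ ()
  vB ≟ᵥ vB = yes refl
  vB ≟ᵥ inner _ _ = no λ ()
  inner _ _ ≟ᵥ vA = no λ ()
  inner _ _ ≟ᵥ vB = no λ ()
  inner i j ≟ᵥ inner i′ j′ with i Fin.≟ i′ | j Fin.≟ j′
  ... | yes refl | yes refl = yes refl
  ... | no i≢i′ | _ = no (inner≢inner i≢i′)
  ... | yes refl | no j≢j′ = no λ { refl → j≢j′ refl }

  pathIndex : V → Fin (suc k)
  pathIndex vA = Fin.fromℕ k
  pathIndex vB = Fin.fromℕ k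
  pathIndex (inner i _) = Fin.inject₁ i

  markedIndex : V → V → Fin (suc k)
  markedIndex a x with x ≟ᵥ a
  ... | yes _ = Fin.fromℕ k
  ... | no _ = pathIndex x

  module _ {S : List V} (gp : IsGeneralPosition E S) where

    noThreeOnThetaPath : ∀ i {x y z} → x ∈ S → y ∈ S → z ∈ S → x ≢ y → y ≢ z → x ≢ z →
      x ∈ walkVertices E (thetaPath i) → y ∈ walkVertices E (thetaPath i) →
      z ∈ walkVertices E (thetaPath i) → ⊥
    noThreeOnThetaPath i x∈S y∈S z∈S x≢y y≢z x≢z x∈P y∈P z∈P =
      proj₂ gp _ _ _ x∈S y∈S z∈S x≢y y≢z x≢z (thetaPath⇒OnCommonGeodesic i x∈P y∈P z∈P)

    noTwoOnEachOfTwoPaths-sorted : ∀ {i i′ a a′ b b′} → i ≢ i′ →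
      toℕ a ≤ toℕ a′ → toℕ b ≤ toℕ b′ →
      inner i a ∈ S → inner i a′ ∈ S → inner i a ≢ inner i a′ →
      inner i′ b ∈ S → inner i′ b′ ∈ S → inner i′ b ≢ inner i′ b′ → ⊥
    noTwoOnEachOfTwoPaths-sorted i≢i′ a≤a′ b≤b′ a∈ a′∈ a≢a′ b∈ b′∈ b≢b′
      with twoPaths⇒OnCommonGeodesic i≢i′ a≤a′ b≤b′
    ... | inj₁ common = proj₂ gp _ _ _ a∈ a′∈ b′∈ a≢a′ (inner≢inner i≢i′) (inner≢inner i≢i′) common
    ... | inj₂ common = proj₂ gp _ _ _ a∈ b∈ b′∈ (inner≢inner i≢i′) b≢b′ (inner≢inner i≢i′) common

    noTwoOnEachOfTwoPaths : ∀ {i i′ a a′ b b′} → i ≢ i′ →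
      inner i a ∈ S → inner i a′ ∈ S → inner i a ≢ inner i a′ →
      inner i′ b ∈ S → inner i′ b′ ∈ S → inner i′ b ≢ inner i′ b′ → ⊥
    noTwoOnEachOfTwoPaths {a = a} {a′} {b} {b′} i≢i′ a∈ a′∈ a≢a′ b∈ b′∈ b≢b′
      with ≤-total (toℕ a) (toℕ a′) | ≤-total (toℕ b) (toℕ b′)
    ... | inj₁ a≤a′ | inj₁ b≤b′ =
      noTwoOnEachOfTwoPaths-sorted i≢i′ a≤a′ b≤b′ a∈ a′∈ a≢a′ b∈ b′∈ b≢b′
    ... | inj₁ a≤a′ | inj₂ b′≤b =
      noTwoOnEachOfTwoPaths-sorted i≢i′ a≤a′ b′≤b a∈ a′∈ a≢a′ b′∈ b∈ (≢-sym b≢b′)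
    ... | inj₂ a′≤a | inj₁ b≤b′ =
      noTwoOnEachOfTwoPaths-sorted i≢i′ a′≤a b≤b′ a′∈ a∈ (≢-sym a≢a′) b∈ b′∈ b≢b′
    ... | inj₂ a′≤a | inj₂ b′≤b =
      noTwoOnEachOfTwoPaths-sorted i≢i′ a′≤a b′≤b a′∈ a∈ (≢-sym a≢a′) b′∈ b∈ (≢-sym b≢b′)

    bothEnds⇒length≤ : vA ∈ S → vB ∈ S → length S ≤ suc k
    bothEnds⇒length≤ A∈ B∈ = ≤-trans (Unique⇒length≤ (proj₁ gp) isB injective) (s≤s (s≤s z≤n))
      where
        isB : V → Fin 2
        isB vB = Fin.suc Fin.zero
        isB _ = Fin.zero
        inner∉S : ∀ {i j} → inner i j ∉ S
        inner∉S {i} x∈ = noThreeOnThetaPath i A∈ x∈ B∈ (λ ()) (λ ()) (λ ())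
          (start∈walkVertices (thetaPath i)) (inner∈thetaPath i _) (end∈walkVertices (thetaPath i))
        injective : ∀ {x y} → x ∈ S → y ∈ S → isB x ≡ isB y → x ≡ y
        injective {inner _ _} x∈ _ _ = ⊥-elim (inner∉S x∈)
        injective {_} {inner _ _} _ y∈ _ = ⊥-elim (inner∉S y∈)
        injective {vA} {vA} _ _ _ = refl
        injective {vB} {vB} _ _ _ = refl

    twoOnPath⇒length≤ : ∀ {i j j′} → inner i j ∈ S → inner i j′ ∈ S → inner i j ≢ inner i j′ →
                        length S ≤ suc k
    twoOnPath⇒length≤ {i} {j} {j′} a∈ b∈ a≢b = Unique⇒length≤ (proj₁ gp) (markedIndex a) injective
      where
        a : V
        a = inner i j
        A∉S : vA ∉ S
        A∉S A∈ = noThreeOnThetaPath i A∈ a∈ b∈ (λ ()) a≢b (λ ())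
          (start∈walkVertices (thetaPath i)) (inner∈thetaPath i j) (inner∈thetaPath i j′)
        B∉S : vB ∉ S
        B∉S B∈ = noThreeOnThetaPath i a∈ b∈ B∈ a≢b (λ ()) (λ ())
          (inner∈thetaPath i j) (inner∈thetaPath i j′) (end∈walkVertices (thetaPath i))
        pathIndex≢fromℕ : ∀ {x} → x ∈ S → pathIndex x ≢ Fin.fromℕ k
        pathIndex≢fromℕ {vA} A∈ _ = A∉S A∈
        pathIndex≢fromℕ {vB} B∈ _ = B∉S B∈
        pathIndex≢fromℕ {inner _ _} _ eq = Finₚ.fromℕ≢inject₁ (sym eq)
        samePathIndex : ∀ {x y} → x ∈ S → y ∈ S → x ≢ a → y ≢ a → pathIndex x ≡ pathIndex y → x ≡ y
        samePathIndex {vA} A∈ _ _ _ _ = ⊥-elim (A∉S A∈)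
        samePathIndex {vB} B∈ _ _ _ _ = ⊥-elim (B∉S B∈)
        samePathIndex {_} {vA} _ A∈ _ _ _ = ⊥-elim (A∉S A∈)
        samePathIndex {_} {vB} _ B∈ _ _ _ = ⊥-elim (B∉S B∈)
        samePathIndex {inner i₁ j₁} {inner _ j₂} x∈ y∈ x≢a y≢a eq with Finₚ.inject₁-injective eq
        ... | refl with inner i₁ j₁ ≟ᵥ inner i₁ j₂
        ...   | yes x≡y = x≡y
        ...   | no x≢y with i₁ Fin.≟ i
        ...     | yes refl = ⊥-elim (noThreeOnThetaPath i x∈ y∈ a∈ x≢y y≢a x≢a
                               (inner∈thetaPath i j₁) (inner∈thetaPath i j₂) (inner∈thetaPath i j))
        ...     | no i₁≢i = ⊥-elim (noTwoOnEachOfTwoPaths i₁≢i x∈ y∈ x≢y a∈ b∈ a≢b)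
        injective : ∀ {x y} → x ∈ S → y ∈ S → markedIndex a x ≡ markedIndex a y → x ≡ y
        injective {x} {y} x∈ y∈ eq with x ≟ᵥ a | y ≟ᵥ a
        ... | yes x≡a | yes y≡a = trans x≡a (sym y≡a)
        ... | yes _ | no _ = ⊥-elim (pathIndex≢fromℕ y∈ (sym eq))
        ... | no _ | yes _ = ⊥-elim (pathIndex≢fromℕ x∈ eq)
        ... | no x≢a | no y≢a = samePathIndex x∈ y∈ x≢a y≢a eq

    sharedPathIndex⇒length≤ : ∀ {x y} → x ∈ S → y ∈ S → x ≢ y → pathIndex x ≡ pathIndex y →
                              length S ≤ suc k
    sharedPathIndex⇒length≤ {vA} {vA} _ _ x≢y _ = ⊥-elim (x≢y refl)
    sharedPathIndex⇒length≤ {vB} {vB} _ _ x≢y _ = ⊥-elim (x≢y refl)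
    sharedPathIndex⇒length≤ {vA} {vB} A∈ B∈ _ _ = bothEnds⇒length≤ A∈ B∈
    sharedPathIndex⇒length≤ {vB} {vA} B∈ A∈ _ _ = bothEnds⇒length≤ A∈ B∈
    sharedPathIndex⇒length≤ {vA} {inner _ _} _ _ _ eq = ⊥-elim (Finₚ.fromℕ≢inject₁ eq)
    sharedPathIndex⇒length≤ {vB} {inner _ _} _ _ _ eq = ⊥-elim (Finₚ.fromℕ≢inject₁ eq)
    sharedPathIndex⇒length≤ {inner _ _} {vA} _ _ _ eq = ⊥-elim (Finₚ.fromℕ≢inject₁ (sym eq))
    sharedPathIndex⇒length≤ {inner _ _} {vB} _ _ _ eq = ⊥-elim (Finₚ.fromℕ≢inject₁ (sym eq))
    sharedPathIndex⇒length≤ {inner _ _} {inner _ _} x∈ y∈ x≢y eq with Finₚ.inject₁-injective eq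
    ... | refl = twoOnPath⇒length≤ x∈ y∈ x≢y

    length≤1+k : length S ≤ suc k
    length≤1+k with any? (λ x → any? (λ y → ¬? (x ≟ᵥ y) ×-dec (pathIndex x Fin.≟ pathIndex y)) S) S
    ... | yes sharing with find sharing
    ...   | x , x∈ , hasPartner with find hasPartner
    ...     | y , y∈ , x≢y , eq = sharedPathIndex⇒length≤ x∈ y∈ x≢y eq
    length≤1+k | no noSharing = Unique⇒length≤ (proj₁ gp) pathIndex injective
      where
        injective : ∀ {x y} → x ∈ S → y ∈ S → pathIndex x ≡ pathIndex y → x ≡ y
        injective {x} {y} x∈ y∈ eq with x ≟ᵥ y
        ... | yes x≡y = x≡y
        ... | no x≢y = ⊥-elim (noSharing (lose x∈ (lose y∈ (x≢y , eq))))

  firstVertex : Fin k → V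
  firstVertex i = inner i Fin.zero

  gpWitness : List V
  gpWitness = vB ∷ tabulate firstVertex

  ∈-gpWitness⁻ : ∀ {x} → x ∈ gpWitness → x ≡ vB ⊎ ∃ λ i → x ≡ firstVertex i
  ∈-gpWitness⁻ (here x≡B) = inj₁ x≡B
  ∈-gpWitness⁻ (there x∈) = inj₂ (∈-tabulate⁻ x∈)

  gpWitness-unique : Unique gpWitness
  gpWitness-unique =
    Allₚ.tabulate⁺ {f = firstVertex} (λ _ ()) ∷ Uniqueₚ.tabulate⁺ {f = firstVertex} λ { refl → refl }

  dist-firstVertex : ∀ {i l} → firstVertex i ≢ firstVertex l → dist (firstVertex i) (firstVertex l) ≡ 2
  dist-firstVertex {i} {l} i≢l = trans (dist-otherPath Fin.zero Fin.zero (i≢l ∘ cong firstVertex))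
                                       (m≤n⇒m⊓n≡m (s≤s (≤-trans (s≤s z≤n) (m≤n+m (suc n) n))))

  gpWitness-isGeneralPosition : 1 ≤ n → IsGeneralPosition E gpWitness
  gpWitness-isGeneralPosition 1≤n = betweenFree⇒IsGeneralPosition gpWitness-unique betweenFree
    where
      viaA : ∀ i l → Walk E (firstVertex i) (firstVertex l)
      viaA i l = first-A i Fin.zero refl ∷ A-first l Fin.zero refl ∷ []
      betweenFree : ∀ {a b c} → a ∈ gpWitness → b ∈ gpWitness → c ∈ gpWitness →
                    a ≢ b → b ≢ c → a ≢ c → ¬ Between a b c
      betweenFree a∈ b∈ c∈ a≢b b≢c a≢c with ∈-gpWitness⁻ a∈ | ∈-gpWitness⁻ b∈ | ∈-gpWitness⁻ c∈
      ... | inj₁ refl | inj₁ refl | _ = ⊥-elim (a≢b refl)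
      ... | _ | inj₁ refl | inj₁ refl = ⊥-elim (b≢c refl)
      ... | inj₁ refl | _ | inj₁ refl = ⊥-elim (a≢c refl)
      ... | inj₂ (i , refl) | inj₂ (j , refl) | inj₂ (l , refl) =
        shortcut⇒¬Between (viaA i l)
          (subst (2 <_) (sym (cong₂ _+_ (dist-firstVertex a≢b) (dist-firstVertex b≢c)))
                 (s≤s (s≤s (s≤s z≤n))))
      ... | inj₂ (i , refl) | inj₁ refl | inj₂ (l , refl) =
        shortcut⇒¬Between (viaA i l) (s≤s (≤-trans (s≤s 1≤n) (m≤n+m (suc n) n)))
      ... | inj₁ refl | inj₂ (j , refl) | inj₂ (l , refl) =
        shortcut⇒¬Between (reverseʷ E-sym (toB l Fin.zero))
          (≤-<-trans (≤-reflexive (trans (walkLength-reverseʷ E-sym _) (walkLength-toB l Fin.zero)))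
            (subst (suc n <_) (sym (cong (suc n +_) (dist-firstVertex b≢c))) (m<m+n (suc n) {2} (s≤s z≤n))))
      ... | inj₂ (i , refl) | inj₂ (j , refl) | inj₁ refl =
        shortcut⇒¬Between (toB i Fin.zero)
          (≤-<-trans (≤-reflexive (walkLength-toB i Fin.zero))
            (subst (suc n <_) (sym (cong (_+ suc n) (dist-firstVertex a≢b))) (m<n+m (suc n) {2} (s≤s z≤n))))

  gpNumber : 1 ≤ n → GpNumberIs E (k + 1)
  gpNumber 1≤n =
    (gpWitness , gpWitness-isGeneralPosition 1≤n , trans (cong suc (length-tabulate firstVertex)) (+-comm 1 k)) ,
    λ S gp → ≤-trans (length≤1+k gp) (≤-reflexive (+-comm 1 k))

proposition2p1 : (k ℓ : ℕ) → 2 ≤ k → 3 ≤ ℓ → GpNumberIs (ThetaAdj k ℓ) (k + 1)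
proposition2p1 (suc k′) (suc (suc n)) _ (s≤s (s≤s 1≤n)) = ThetaGraph.gpNumber k′ n 1≤n
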